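{- Let $G$ be a connected graph with at least two vertices. Then \[ \operatorname{gp}(G) \leq \operatorname{gp}_f(G) \leq 2\rho(G). \]
   Context: All graphs are finite and simple. A shortest path (geodesic) in $G$ is a path between two vertices $u,v$ of length equal to the distance $d_G(u,v)$. A set $S\subseteq V(G)$ is a general position set if no three vertices of $S$ lie on a common shortest path of $G$; $\operatorname{gp}(G)$ is the maximum cardinality of a general position set of $G$. A general position labelling of $G$ is a function $f\colon V(G)\to \mathbb{R}_{\ge 0}$ such that for every shortest path $P$ of $G$, $\sum_{u\in V(P)} f(u)\le 2$. The fractional general position number $\operatorname{gp}_f(G)$ is the maximum of $\sum_{u\in V(G)} f(u)$ over all general position labellings $f$ of $G$. The isometric-path number $\rho(G)$ is the smallest number of shortest paths of $G$ whose vertex sets together cover $V(G)$.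
   Formalization: General position labellings take values in the nonnegative rationals instead of $\mathbb{R}_{\ge 0}$. -}

module Defs where

open import Data.Nat as ℕ using (ℕ; suc)
open import Data.Bool using (Bool; true; false)
open import Data.Fin using (Fin)
open import Data.List using (List; []; _∷_; length; foldr; map; allFin)
open import Data.List.Membership.Propositional using (_∈_)
open import Data.List.Relation.Unary.Any using (Any)
open import Data.List.Relation.Unary.Unique.Propositional using (Unique)
open import Data.Product using (Σ; ∃; _×_; _,_)
open import Data.Integer using (+_)
open import Data.Rational as ℚ using (ℚ; 0ℚ; _/_)
open import Relation.Binary.PropositionalEquality using (_≡_; _≢_)
open import Relation.Nullary using (¬_)

record Graph : Set where
  field
    n        : ℕ
    adj      : Fin n → Fin n → Bool
    adj-sym  : ∀ u v → adj u v ≡ adj v u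
    adj-irr  : ∀ u → adj u u ≡ false

module _ (G : Graph) where
  open Graph G

  Vertex : Set
  Vertex = Fin n

  Adj : Vertex → Vertex → Set
  Adj u v = adj u v ≡ true

  IsWalk : List Vertex → Set
  IsWalk []           = Data.Unit.⊤ where import Data.Unit
  IsWalk (x ∷ [])     = Data.Unit.⊤ where import Data.Unit
  IsWalk (x ∷ y ∷ xs) = Adj x y × IsWalk (y ∷ xs)

  data Starts : Vertex → List Vertex → Set where
    here : ∀ {u xs} → Starts u (u ∷ xs)

  data Ends : Vertex → List Vertex → Set where
    last : ∀ {v} → Ends v (v ∷ [])
    there : ∀ {v x xs} → Ends v xs → Ends v (x ∷ xs)

  WalkBetween : Vertex → Vertex → List Vertex → Set
  WalkBetween u v p = Starts u p × Ends v p × IsWalk p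

  -- the number of edges of a walk given by its vertex list p is length p - 1;
  -- comparing vertex counts is the same as comparing lengths.
  -- A shortest path (geodesic): a u,v-walk such that no u,v-walk is shorter
  -- (its length equals d_G(u,v); such a walk is automatically a path).
  IsGeodesic : List Vertex → Set
  IsGeodesic p = Σ Vertex λ u → Σ Vertex λ v →
    WalkBetween u v p ×
    (∀ q → WalkBetween u v q → length p ℕ.≤ length q)

  Connected : Set
  Connected = ∀ u v → ∃ λ p → WalkBetween u v p

  IsGPSet : List Vertex → Set
  IsGPSet S = Unique S ×
    (∀ x y z → x ∈ S → y ∈ S → z ∈ S → x ≢ y → y ≢ z → x ≢ z →
      ¬ (Σ (List Vertex) λ P → IsGeodesic P × x ∈ P × y ∈ P × z ∈ P))

  IsGP : ℕ → Set
  IsGP k = (Σ (List Vertex) λ S → IsGPSet S × length S ≡ k) ×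
           (∀ S → IsGPSet S → length S ℕ.≤ k)

  IsIsometricPathCover : List (List Vertex) → Set
  IsIsometricPathCover Ps =
    (∀ P → P ∈ Ps → IsGeodesic P) × (∀ v → Any (v ∈_) Ps)

  IsRho : ℕ → Set
  IsRho k = (Σ (List (List Vertex)) λ Ps → IsIsometricPathCover Ps × length Ps ≡ k) ×
            (∀ Ps → IsIsometricPathCover Ps → k ℕ.≤ length Ps)

  sumℚ : List ℚ → ℚ
  sumℚ = foldr ℚ._+_ 0ℚ

  -- weight of a vertex list (a geodesic has pairwise distinct vertices,
  -- so this is the sum over its vertex set)
  weight : (Vertex → ℚ) → List Vertex → ℚ
  weight f P = sumℚ (map f P)

  IsGPLabelling : (Vertex → ℚ) → Set
  IsGPLabelling f = (∀ v → 0ℚ ℚ.≤ f v) ×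
                    (∀ P → IsGeodesic P → weight f P ℚ.≤ ((+ 2) / 1))

  total : (Vertex → ℚ) → ℚ
  total f = weight f (allFin n)

  IsGPf : ℚ → Set
  IsGPf q = (Σ (Vertex → ℚ) λ f → IsGPLabelling f × total f ≡ q) ×
            (∀ f → IsGPLabelling f → total f ℚ.≤ q)

ℕtoℚ : ℕ → ℚ
ℕtoℚ k = (+ k) / 1

-- The indicator function of a general position set S is a general position
-- labelling: a shortest path repeats no vertex (otherwise it could be
-- shortcut), so it meets S in at most two vertices. Hence gp ≤ gp_f.
-- Conversely, if f is a general position labelling and P₁, …, P_ρ are
-- shortest paths covering V(G), then, labels being nonnegative,
-- Σ_u f(u) ≤ Σ_i Σ_{u ∈ P_i} f(u) ≤ 2ρ.
module Submission where

open import Defs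
open import Data.Bool using (if_then_else_)
open import Data.Empty using (⊥; ⊥-elim)
open import Data.Fin as Fin using ()
open import Data.Integer as ℤ using (+_; +≤+)
import Data.Integer.Properties as ℤ
open import Data.List using (List; []; _∷_; _++_; length; map; foldr; allFin; concat; filter)
open import Data.List.Properties using (filter-all)
open import Data.List.Membership.Propositional using (_∈_)
open import Data.List.Membership.Propositional.Properties
  using (∈-∃++; ∈-++⁻; ∈-++⁺ˡ; ∈-++⁺ʳ; ∈-filter⁻; ∈-allFin; ∈-concat⁺)
import Data.List.Membership.DecPropositional as DecMembership
open import Data.List.Relation.Binary.Subset.Propositional using (_⊆_)
open import Data.List.Relation.Unary.Any using (here; there)
open import Data.List.Relation.Unary.All as All using ([]; _∷_)
open import Data.List.Relation.Unary.All.Properties using (¬Any⇒All¬)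
open import Data.List.Relation.Unary.AllPairs using ([]; _∷_)
open import Data.List.Relation.Unary.Unique.Propositional using (Unique)
open import Data.List.Relation.Unary.Unique.Propositional.Properties using (allFin⁺; filter⁺)
open import Data.Nat as ℕ using (ℕ; suc; _≤_; _<_; _*_; z≤n; s≤s)
import Data.Nat.Properties as ℕ
open import Data.Product using (∃; _×_; _,_; proj₁; proj₂)
open import Data.Rational as ℚ using (ℚ; 0ℚ; 1ℚ; toℚᵘ)
import Data.Rational.Properties as ℚ
open import Data.Rational.Unnormalised as ℚᵘ using (ℚᵘ; mkℚᵘ; *≡*; *≤*)
import Data.Rational.Unnormalised.Properties as ℚᵘ
open import Data.Sum using (_⊎_; inj₁; inj₂)
open import Function using (_∘_; id)
open import Relation.Binary.Definitions using (DecidableEquality)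
open import Relation.Binary.PropositionalEquality
open import Relation.Nullary using (Dec; yes; no; does; contradiction)

-- ℕtoℚ normalises by a gcd, so its arithmetic is transported from ℚᵘ along toℚᵘ.
ℕtoℚᵘ : ℕ → ℚᵘ
ℕtoℚᵘ k = mkℚᵘ (+ k) 0

toℚᵘ-ℕtoℚ : ∀ k → toℚᵘ (ℕtoℚ k) ℚᵘ.≃ ℕtoℚᵘ k
toℚᵘ-ℕtoℚ k = ℚ.toℚᵘ-fromℚᵘ (ℕtoℚᵘ k)

ℕtoℚ-homo-+ : ∀ m n → ℕtoℚ (m ℕ.+ n) ≡ ℕtoℚ m ℚ.+ ℕtoℚ n
ℕtoℚ-homo-+ m n = ℚ.toℚᵘ-injective (begin
  toℚᵘ (ℕtoℚ (m ℕ.+ n))             ≈⟨ toℚᵘ-ℕtoℚ (m ℕ.+ n) ⟩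
  ℕtoℚᵘ (m ℕ.+ n)                   ≈⟨ ℕtoℚᵘ-homo-+ ⟩
  ℕtoℚᵘ m ℚᵘ.+ ℕtoℚᵘ n              ≈⟨ ℚᵘ.+-cong (toℚᵘ-ℕtoℚ m) (toℚᵘ-ℕtoℚ n) ⟨
  toℚᵘ (ℕtoℚ m) ℚᵘ.+ toℚᵘ (ℕtoℚ n)  ≈⟨ ℚ.toℚᵘ-homo-+ (ℕtoℚ m) (ℕtoℚ n) ⟨
  toℚᵘ (ℕtoℚ m ℚ.+ ℕtoℚ n)          ∎)
  where
  open ℚᵘ.≃-Reasoning
  ℕtoℚᵘ-homo-+ : ℕtoℚᵘ (m ℕ.+ n) ℚᵘ.≃ ℕtoℚᵘ m ℚᵘ.+ ℕtoℚᵘ n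
  ℕtoℚᵘ-homo-+ = *≡* (cong (ℤ._* + 1) (trans (ℤ.pos-+ m n)
    (sym (cong₂ ℤ._+_ (ℤ.*-identityʳ (+ m)) (ℤ.*-identityʳ (+ n))))))

ℕtoℚ-mono-≤ : ∀ {m n} → m ≤ n → ℕtoℚ m ℚ.≤ ℕtoℚ n
ℕtoℚ-mono-≤ {m} {n} m≤n = ℚ.toℚᵘ-cancel-≤
  (ℚᵘ.≤-respˡ-≃ (ℚᵘ.≃-sym (toℚᵘ-ℕtoℚ m)) (ℚᵘ.≤-respʳ-≃ (ℚᵘ.≃-sym (toℚᵘ-ℕtoℚ n))
    (*≤* (ℤ.*-monoʳ-≤-nonNeg (+ 1) (+≤+ m≤n)))))

ℕtoℚ-2*-suc : ∀ k → ℕtoℚ (2 * suc k) ≡ ℕtoℚ 2 ℚ.+ ℕtoℚ (2 * k)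
ℕtoℚ-2*-suc k = trans (cong ℕtoℚ (ℕ.*-suc 2 k)) (ℕtoℚ-homo-+ 2 (2 * k))

module _ {A : Set} where

  ∑ : (A → ℚ) → List A → ℚ
  ∑ f xs = foldr ℚ._+_ 0ℚ (map f xs)

  ∑-++ : ∀ f xs ys → ∑ f (xs ++ ys) ≡ ∑ f xs ℚ.+ ∑ f ys
  ∑-++ f []       ys = sym (ℚ.+-identityˡ (∑ f ys))
  ∑-++ f (x ∷ xs) ys = trans (cong (f x ℚ.+_) (∑-++ f xs ys)) (sym (ℚ.+-assoc (f x) _ _))

  ∑-insert : ∀ f xs x ys → ∑ f (xs ++ x ∷ ys) ≡ f x ℚ.+ ∑ f (xs ++ ys)
  ∑-insert f []       x ys = refl
  ∑-insert f (y ∷ xs) x ys = begin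
    f y ℚ.+ ∑ f (xs ++ x ∷ ys)        ≡⟨ cong (f y ℚ.+_) (∑-insert f xs x ys) ⟩
    f y ℚ.+ (f x ℚ.+ ∑ f (xs ++ ys))  ≡⟨ ℚ.+-assoc (f y) (f x) _ ⟨
    (f y ℚ.+ f x) ℚ.+ ∑ f (xs ++ ys)  ≡⟨ cong (ℚ._+ ∑ f (xs ++ ys)) (ℚ.+-comm (f y) (f x)) ⟩
    (f x ℚ.+ f y) ℚ.+ ∑ f (xs ++ ys)  ≡⟨ ℚ.+-assoc (f x) (f y) _ ⟩
    f x ℚ.+ (f y ℚ.+ ∑ f (xs ++ ys))  ∎
    where open ≡-Reasoning

  ∑-nonneg : ∀ {f} → (∀ x → 0ℚ ℚ.≤ f x) → ∀ xs → 0ℚ ℚ.≤ ∑ f xs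
  ∑-nonneg f≥0 []       = ℚ.≤-refl
  ∑-nonneg f≥0 (x ∷ xs) = ℚ.+-mono-≤ (f≥0 x) (∑-nonneg f≥0 xs)

  ∑-mono-⊆ : ∀ {f} → (∀ x → 0ℚ ℚ.≤ f x) →
             ∀ {xs ys} → Unique xs → xs ⊆ ys → ∑ f xs ℚ.≤ ∑ f ys
  ∑-mono-⊆ f≥0 {[]}     {ys} _ _ = ∑-nonneg f≥0 ys
  ∑-mono-⊆ {f} f≥0 {x ∷ xs} (x∉xs ∷ xs!) xs⊆ys
    with as , bs , refl ← ∈-∃++ (xs⊆ys (here refl)) = begin
      f x ℚ.+ ∑ f xs         ≤⟨ ℚ.+-monoʳ-≤ (f x) (∑-mono-⊆ f≥0 xs! xs⊆as++bs) ⟩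
      f x ℚ.+ ∑ f (as ++ bs) ≡⟨ ∑-insert f as x bs ⟨
      ∑ f (as ++ x ∷ bs)     ∎
    where
    open ℚ.≤-Reasoning
    xs⊆as++bs : xs ⊆ as ++ bs
    xs⊆as++bs {y} y∈xs with ∈-++⁻ as (xs⊆ys (there y∈xs))
    ... | inj₁ y∈as         = ∈-++⁺ˡ y∈as
    ... | inj₂ (here refl)  = contradiction refl (All.lookup x∉xs y∈xs)
    ... | inj₂ (there y∈bs) = ∈-++⁺ʳ as y∈bs

  unique⊎repeats : DecidableEquality A → ∀ (xs : List A) → Unique xs ⊎
    ∃ λ as → ∃ λ x → ∃ λ bs → ∃ λ cs → xs ≡ as ++ x ∷ bs ++ x ∷ cs
  unique⊎repeats _≟_ [] = inj₁ []
  unique⊎repeats _≟_ (y ∷ xs) with unique⊎repeats _≟_ xs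
  ... | inj₂ (as , x , bs , cs , refl) = inj₂ (y ∷ as , x , bs , cs , refl)
  ... | inj₁ xs! with DecMembership._∈?_ _≟_ y xs
  ...   | no  y∉xs = inj₁ (¬Any⇒All¬ xs y∉xs ∷ xs!)
  ...   | yes y∈xs with bs , cs , refl ← ∈-∃++ y∈xs = inj₂ ([] , y , bs , cs , refl)

  length-shortcut : ∀ as (x : A) bs cs → length (as ++ x ∷ cs) < length (as ++ x ∷ bs ++ x ∷ cs)
  length-shortcut []       x []       cs = ℕ.n<1+n _
  length-shortcut []       x (b ∷ bs) cs = s≤s (ℕ.<⇒≤ (length-shortcut [] x bs cs))
  length-shortcut (a ∷ as) x bs       cs = s≤s (length-shortcut as x bs cs)

  length≤2 : ∀ {xs : List A} → Unique xs →
    (∀ {x y z} → x ∈ xs → y ∈ xs → z ∈ xs → x ≢ y → y ≢ z → x ≢ z → ⊥) →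
    length xs ≤ 2
  length≤2 {[]}          _ _ = z≤n
  length≤2 {_ ∷ []}      _ _ = s≤s z≤n
  length≤2 {_ ∷ _ ∷ []}  _ _ = s≤s (s≤s z≤n)
  length≤2 {_ ∷ _ ∷ _ ∷ _} ((x≢y ∷ x≢z ∷ _) ∷ (y≢z ∷ _) ∷ _) no-three = ⊥-elim (
    no-three (here refl) (there (here refl)) (there (there (here refl))) x≢y y≢z x≢z)

module _ (G : Graph) where

  Starts-shortcut : ∀ {u} as {x : Vertex G} bs cs →
    Starts G u (as ++ x ∷ bs ++ x ∷ cs) → Starts G u (as ++ x ∷ cs)
  Starts-shortcut []      _ _ here = here
  Starts-shortcut (_ ∷ _) _ _ here = here

  Ends-suffix : ∀ {v} as {x : Vertex G} cs → Ends G v (as ++ x ∷ cs) → Ends G v (x ∷ cs)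
  Ends-suffix []           cs e         = e
  Ends-suffix (_ ∷ [])     cs (there e) = e
  Ends-suffix (_ ∷ a ∷ as) cs (there e) = Ends-suffix (a ∷ as) cs e

  Ends-shortcut : ∀ {v} as {x : Vertex G} bs cs →
    Ends G v (as ++ x ∷ bs ++ x ∷ cs) → Ends G v (as ++ x ∷ cs)
  Ends-shortcut [] {x}       bs cs e         = Ends-suffix (x ∷ bs) cs e
  Ends-shortcut (_ ∷ [])     bs cs (there e) = there (Ends-shortcut [] bs cs e)
  Ends-shortcut (_ ∷ a ∷ as) bs cs (there e) = there (Ends-shortcut (a ∷ as) bs cs e)

  IsWalk-suffix : ∀ as (cs : List (Vertex G)) → IsWalk G (as ++ cs) → IsWalk G cs
  IsWalk-suffix []           cs      w       = w
  IsWalk-suffix (_ ∷ [])     []      _       = _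
  IsWalk-suffix (_ ∷ [])     (_ ∷ _) (_ , w) = w
  IsWalk-suffix (_ ∷ a ∷ as) cs      (_ , w) = IsWalk-suffix (a ∷ as) cs w

  IsWalk-shortcut : ∀ as {x : Vertex G} bs cs →
    IsWalk G (as ++ x ∷ bs ++ x ∷ cs) → IsWalk G (as ++ x ∷ cs)
  IsWalk-shortcut [] {x}       bs cs w       = IsWalk-suffix (x ∷ bs) (x ∷ cs) w
  IsWalk-shortcut (_ ∷ [])     bs cs (e , w) = e , IsWalk-shortcut [] bs cs w
  IsWalk-shortcut (_ ∷ a ∷ as) bs cs (e , w) = e , IsWalk-shortcut (a ∷ as) bs cs w

  WalkBetween-shortcut : ∀ {u v} as {x : Vertex G} bs cs →
    WalkBetween G u v (as ++ x ∷ bs ++ x ∷ cs) → WalkBetween G u v (as ++ x ∷ cs)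
  WalkBetween-shortcut as bs cs (s , e , w) =
    Starts-shortcut as bs cs s , Ends-shortcut as bs cs e , IsWalk-shortcut as bs cs w

  geodesic⇒Unique : ∀ {P} → IsGeodesic G P → Unique P
  geodesic⇒Unique {P} (u , v , walk , shortest) with unique⊎repeats Fin._≟_ P
  ... | inj₁ P!                          = P!
  ... | inj₂ (as , x , bs , cs , refl) =
    contradiction (shortest _ (WalkBetween-shortcut as bs cs walk))
                  (ℕ.<⇒≱ (length-shortcut as x bs cs))

module _ (G : Graph) where
  _∈?_ : (v : Vertex G) (S : List (Vertex G)) → Dec (v ∈ S)
  _∈?_ = DecMembership._∈?_ Fin._≟_

  indicator : List (Vertex G) → Vertex G → ℚ
  indicator S v = if does (v ∈? S) then 1ℚ else 0ℚ

  indicator-nonneg : ∀ S v → 0ℚ ℚ.≤ indicator S v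
  indicator-nonneg S v with v ∈? S
  ... | yes _ = ℕtoℚ-mono-≤ {0} {1} z≤n
  ... | no  _ = ℚ.≤-refl

  weight-indicator : ∀ S P → weight G (indicator S) P ≡ ℕtoℚ (length (filter (_∈? S) P))
  weight-indicator S []      = refl
  weight-indicator S (v ∷ P) with v ∈? S
  ... | yes _ = trans (cong (1ℚ ℚ.+_) (weight-indicator S P))
                      (sym (ℕtoℚ-homo-+ 1 (length (filter (_∈? S) P))))
  ... | no  _ = trans (ℚ.+-identityˡ _) (weight-indicator S P)

  geodesic-meets-gpSet≤2 : ∀ {S P} → IsGPSet G S → IsGeodesic G P →
    length (filter (_∈? S) P) ≤ 2
  geodesic-meets-gpSet≤2 {S} {P} (_ , no-three-on-geodesic) geo =
    length≤2 (filter⁺ (_∈? S) (geodesic⇒Unique G geo)) λ x∈ y∈ z∈ x≢y y≢z x≢z →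
      let (x∈P , x∈S) = ∈-filter⁻ (_∈? S) x∈
          (y∈P , y∈S) = ∈-filter⁻ (_∈? S) y∈
          (z∈P , z∈S) = ∈-filter⁻ (_∈? S) z∈
      in no-three-on-geodesic _ _ _ x∈S y∈S z∈S x≢y y≢z x≢z (P , geo , x∈P , y∈P , z∈P)

  indicator-isGPLabelling : ∀ {S} → IsGPSet G S → IsGPLabelling G (indicator S)
  indicator-isGPLabelling {S} S-gp = indicator-nonneg S , λ P geo →
    subst (ℚ._≤ ℕtoℚ 2) (sym (weight-indicator S P))
          (ℕtoℚ-mono-≤ (geodesic-meets-gpSet≤2 S-gp geo))

  length≤total-indicator : ∀ {S} → Unique S → ℕtoℚ (length S) ℚ.≤ total G (indicator S)
  length≤total-indicator {S} S! = begin
    ℕtoℚ (length S)                   ≡⟨ cong (ℕtoℚ ∘ length) (filter-all (_∈? S) (All.tabulate id)) ⟨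
    ℕtoℚ (length (filter (_∈? S) S))  ≡⟨ weight-indicator S S ⟨
    weight G (indicator S) S          ≤⟨ ∑-mono-⊆ (indicator-nonneg S) S! (λ {v} _ → ∈-allFin v) ⟩
    total G (indicator S)             ∎
    where open ℚ.≤-Reasoning

  weight-concat-geodesics≤ : ∀ {f} → IsGPLabelling G f →
    ∀ Ps → (∀ P → P ∈ Ps → IsGeodesic G P) → ∑ f (concat Ps) ℚ.≤ ℕtoℚ (2 * length Ps)
  weight-concat-geodesics≤ f-gp []       _   = ℚ.≤-refl
  weight-concat-geodesics≤ {f} f-gp (P ∷ Ps) geo = begin
    ∑ f (P ++ concat Ps)             ≡⟨ ∑-++ f P (concat Ps) ⟩
    ∑ f P ℚ.+ ∑ f (concat Ps)        ≤⟨ ℚ.+-mono-≤ (proj₂ f-gp P (geo P (here refl)))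
                                         (weight-concat-geodesics≤ f-gp Ps (λ Q → geo Q ∘ there)) ⟩
    ℕtoℚ 2 ℚ.+ ℕtoℚ (2 * length Ps)  ≡⟨ ℕtoℚ-2*-suc (length Ps) ⟨
    ℕtoℚ (2 * suc (length Ps))       ∎
    where open ℚ.≤-Reasoning

  total≤2*length-cover : ∀ {f Ps} → IsGPLabelling G f → IsIsometricPathCover G Ps →
    total G f ℚ.≤ ℕtoℚ (2 * length Ps)
  total≤2*length-cover {Ps = Ps} f-gp (geo , cover) = ℚ.≤-trans
    (∑-mono-⊆ (proj₁ f-gp) (allFin⁺ (Graph.n G)) (λ {v} _ → ∈-concat⁺ (cover v)))
    (weight-concat-geodesics≤ f-gp Ps geo)

mainTheorem1 : (G : Graph) → 2 ≤ Graph.n G → Connected G →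
    ∀ g r q → IsGP G g → IsRho G r → IsGPf G q →
    (ℕtoℚ g ℚ.≤ q) × (q ℚ.≤ ℕtoℚ (2 * r))
mainTheorem1 G _ _ _ _ _ ((S , S-gp , refl) , _) ((Ps , cover , refl) , _) ((f , f-gp , refl) , f-max) =
  ℚ.≤-trans (length≤total-indicator G (proj₁ S-gp)) (f-max _ (indicator-isGPLabelling G S-gp)) ,
  total≤2*length-cover G f-gp cover
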